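{- Let $p\geq 11$ be a prime and let $t$ be an odd integer with $5\leq t\leq p-2$. For $1\leq a\leq p-1$, let $\omega(a)$ be the unique root in $\mathbb{Z}_p$ of $X^{p-1}-1$ with $\omega(a)\equiv a\pmod p$, and write $\omega(a)=a+pv_a$ with $v_a\in\mathbb{Z}_p$. Then (Version 1) $\displaystyle\sum_{a=1}^{p-1}q_a^2a^t\equiv-\sum_{a=1}^{p-1}q_aa^{t-1}\pmod p$, and (Version 2) $\displaystyle\sum_{a=1}^{p-1}q_aa^{t-1}(1+v_a)\equiv 0\pmod p$.
   Context: For $1\leq a\leq p-1$, $q_a:=\frac{a^{p-1}-1}{p}$ is the Fermat quotient. Congruences are in $\mathbb{Z}_p$: $x\equiv y\pmod{p^k}$ means $x-y\in p^k\mathbb{Z}_p$. -}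

module Defs where

open import Data.Nat as ℕ using (ℕ; zero; suc)
open import Data.Integer using (ℤ; +_; 0ℤ; _+_; _-_; _*_; _^_)
open import Data.Integer.Divisibility using (_∣_)

sum1to : ℕ → (ℕ → ℤ) → ℤ
sum1to zero    f = 0ℤ
sum1to (suc n) f = sum1to n f + f (suc n)

_≡_[mod_] : ℤ → ℤ → ℕ → Set
x ≡ y [mod m ] = (+ m) ∣ (x - y)

-- For 1 ≤ a ≤ p-1 and p prime the division is exact (Fermat), and
-- a^(p-1) ≥ 1 so the truncated subtraction is the true one.
-- (p = 0 is never used; it is given the dummy value 0.)
fermatQuotient : ℕ → ℕ → ℤ
fermatQuotient zero    a = 0ℤ
fermatQuotient (suc k) a = + ((a ℕ.^ k ℕ.∸ 1) ℕ./ suc k)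

{-# OPTIONS --safe #-}
module Submission where

-- Put F(a) = qₐ² aᵗ + qₐ aᵗ⁻¹ = aᵗ⁻² · u (u + 1) with u = a qₐ.  Expanding
-- (p − a)ᵖ⁻¹ = (−a + p)ᵖ⁻¹ to first order in p gives a q₍ₚ₋ₐ₎ ≡ a qₐ + 1, so
-- a ↦ p − a sends u to −(u + 1), which fixes u (u + 1), while aᵗ⁻² changes sign
-- because t is odd.  Hence Σ F(a) ≡ −Σ F(a) (mod p), and Σ F(a) ≡ 0 since p is
-- odd: this is Version 1.  Expanding (a + p vₐ)ᵖ⁻¹ ≡ 1 (mod p²) in the same way
-- gives vₐ ≡ a qₐ, so the summand of Version 2 is F(a) modulo p as well.

open import Defs
open import Data.Nat.Base as ℕ using (ℕ; zero; suc; _≤_; _<_; _∸_; s≤s; z≤n)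
import Data.Nat.Properties as ℕP
open import Data.Nat.Divisibility as ND using (divides)
open import Data.Nat.DivMod using (m*[n/m]≡n)
open import Data.Nat.Primality using (Prime; euclidsLemma; prime⇒irreducible)
open import Data.Product.Base using (_×_; ∃-syntax; _,_)
open import Data.Sum.Base using (inj₁; inj₂)
open import Function.Base using (_∘_)
open import Relation.Nullary using (¬_; contradiction)
open import Relation.Binary.Bundles using (Setoid)
open import Relation.Binary.PropositionalEquality
  using (_≡_; _≢_; refl; cong; cong₂; sym; trans; subst; module ≡-Reasoning)
import Relation.Binary.Reasoning.Setoid

module Fermat where
  open import Data.Nat.Base using (_+_; _*_; _^_)
  open import Data.Nat.Combinatorics using (_C_; nCk+nC[k+1]≡[n+1]C[k+1]; nC1≡n; nCn≡1)
  open import Data.Nat.Tactic.RingSolver using (solve-∀)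
  open import Data.Fin.Base as Fin using (Fin; toℕ; inject₁; fromℕ)
  open import Data.Fin.Properties using (toℕ<n; toℕ-inject₁; toℕ-fromℕ)
  open import Data.Vec.Functional using (init; last; tail)
  import Algebra.Properties.CommutativeSemiring.Binomial ℕP.+-*-commutativeSemiring as Binomial
  import Algebra.Properties.Semiring.Sum ℕP.+-*-semiring as Sum
  import Algebra.Definitions.RawSemiring ℕ.+-*-rawSemiring as Raw
  open ≡-Reasoning

  [k+1]*[n+1]C[k+1]≡[n+1]*nCk : ∀ n k → suc k * (suc n C suc k) ≡ suc n * (n C k)
  [k+1]*[n+1]C[k+1]≡[n+1]*nCk zero    zero    = refl
  [k+1]*[n+1]C[k+1]≡[n+1]*nCk zero    (suc k) = ℕP.*-zeroʳ (2 + k)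
  [k+1]*[n+1]C[k+1]≡[n+1]*nCk (suc n) zero    = begin
    1 * ((2 + n) C 1) ≡⟨ ℕP.*-identityˡ _ ⟩
    (2 + n) C 1       ≡⟨ nC1≡n (2 + n) ⟩
    2 + n             ≡⟨ ℕP.*-identityʳ (2 + n) ⟨
    (2 + n) * 1       ∎
  [k+1]*[n+1]C[k+1]≡[n+1]*nCk (suc n) (suc k) = begin
    (2 + k) * ((2 + n) C (2 + k))
      ≡⟨ cong ((2 + k) *_) (nCk+nC[k+1]≡[n+1]C[k+1] (suc n) (suc k)) ⟨
    (2 + k) * (suc n C suc k + suc n C (2 + k))
      ≡⟨ ℕP.*-distribˡ-+ (2 + k) (suc n C suc k) _ ⟩
    (2 + k) * (suc n C suc k) + (2 + k) * (suc n C (2 + k))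
      ≡⟨ cong₂ (λ a b → suc n C suc k + a + b)
               ([k+1]*[n+1]C[k+1]≡[n+1]*nCk n k) ([k+1]*[n+1]C[k+1]≡[n+1]*nCk n (suc k)) ⟩
    suc n C suc k + suc n * (n C k) + suc n * (n C suc k)
      ≡⟨ regroup (suc n C suc k) (suc n) (n C k) (n C suc k) ⟩
    suc n C suc k + suc n * (n C k + n C suc k)
      ≡⟨ cong (λ c → suc n C suc k + suc n * c) (nCk+nC[k+1]≡[n+1]C[k+1] n k) ⟩
    (2 + n) * (suc n C suc k)
      ∎
    where
    regroup : ∀ a m b c → a + m * b + m * c ≡ a + m * (b + c)
    regroup = solve-∀

  p∣pC[k+1] : ∀ {n k} → Prime (suc n) → k < n → suc n ND.∣ suc n C suc k
  p∣pC[k+1] {n} {k} p-prime k<n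
    with euclidsLemma (suc k) (suc n C suc k) p-prime (divides (n C k) absorption)
    where
    absorption : suc k * (suc n C suc k) ≡ (n C k) * suc n
    absorption = trans ([k+1]*[n+1]C[k+1]≡[n+1]*nCk n k) (ℕP.*-comm (suc n) (n C k))
  ... | inj₁ p∣1+k = contradiction (ND.∣⇒≤ p∣1+k) (ℕP.<⇒≱ (s≤s k<n))
  ... | inj₂ p∣C   = p∣C

  ∣-sum : ∀ {d n} (f : Fin n → ℕ) → (∀ i → d ND.∣ f i) → d ND.∣ Sum.sum f
  ∣-sum {n = zero}  f d∣f = ND._∣0 _
  ∣-sum {n = suc n} f d∣f = ND.∣m∣n⇒∣m+n (d∣f Fin.zero) (∣-sum (tail f) (d∣f ∘ Fin.suc))

  ×≡* : ∀ m x → m Raw.× x ≡ m * x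
  ×≡* zero    x = refl
  ×≡* (suc m) x = cong (x +_) (×≡* m x)

  ^≡^ : ∀ x m → x Raw.^ m ≡ x ^ m
  ^≡^ x zero    = refl
  ^≡^ x (suc m) = cong (x *_) (^≡^ x m)

  binomialTerm≡ : ∀ x n k → Binomial.binomialTerm x 1 n k ≡ (n C toℕ k) * x ^ toℕ k
  binomialTerm≡ x n k = begin
    (n C toℕ k) Raw.× (x Raw.^ toℕ k * 1 Raw.^ (n ∸ toℕ k))
      ≡⟨ ×≡* (n C toℕ k) _ ⟩
    (n C toℕ k) * (x Raw.^ toℕ k * 1 Raw.^ (n ∸ toℕ k))
      ≡⟨ cong₂ (λ a b → (n C toℕ k) * (a * b)) (^≡^ x (toℕ k)) 1^[n-k]≡1 ⟩
    (n C toℕ k) * (x ^ toℕ k * 1)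
      ≡⟨ cong ((n C toℕ k) *_) (ℕP.*-identityʳ (x ^ toℕ k)) ⟩
    (n C toℕ k) * x ^ toℕ k
      ∎
    where
    1^[n-k]≡1 : 1 Raw.^ (n ∸ toℕ k) ≡ 1
    1^[n-k]≡1 = trans (^≡^ 1 (n ∸ toℕ k)) (ℕP.^-zeroˡ (n ∸ toℕ k))

  [x+1]^p≡x^p+1+m*p : ∀ {n} → Prime (suc n) → ∀ x →
                      ∃[ m ] (x + 1) ^ suc n ≡ x ^ suc n + 1 + m * suc n
  [x+1]^p≡x^p+1+m*p {n} p-prime x
    with ∣-sum (init (tail (Binomial.binomialTerm x 1 (suc n)))) p∣middle
    where
    p∣middle : ∀ i → suc n ND.∣ Binomial.binomialTerm x 1 (suc n) (Fin.suc (inject₁ i))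
    p∣middle i = subst (suc n ND.∣_) (sym (binomialTerm≡ x (suc n) (Fin.suc (inject₁ i))))
      (ND.∣m⇒∣m*n _ (p∣pC[k+1] p-prime (subst (_< n) (sym (toℕ-inject₁ i)) (toℕ<n i))))
  ... | divides m middle = m , (begin
    (x + 1) ^ p                          ≡⟨ ^≡^ (x + 1) p ⟨
    (x + 1) Raw.^ p                      ≡⟨ Binomial.theorem p x 1 ⟩
    term Fin.zero + Sum.sum (tail term)  ≡⟨ cong (term Fin.zero +_) (Sum.sum-init-last (tail term)) ⟩
    term Fin.zero + (Sum.sum (init (tail term)) + last (tail term))
      ≡⟨ cong₂ _+_ (binomialTerm≡ x p Fin.zero) (cong₂ _+_ middle last≡x^p) ⟩
    1 + (m * p + x ^ p)                  ≡⟨ shuffle 1 (m * p) (x ^ p) ⟩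
    x ^ p + 1 + m * p                    ∎)
    where
    p = suc n
    term = Binomial.binomialTerm x 1 p
    last≡x^p : last (tail term) ≡ x ^ p
    last≡x^p = begin
      term (fromℕ p)                          ≡⟨ binomialTerm≡ x p (fromℕ p) ⟩
      (p C toℕ (fromℕ p)) * x ^ toℕ (fromℕ p) ≡⟨ cong (λ k → (p C k) * x ^ k) (toℕ-fromℕ p) ⟩
      (p C p) * x ^ p                         ≡⟨ cong (_* x ^ p) (nCn≡1 p) ⟩
      1 * x ^ p                               ≡⟨ ℕP.*-identityˡ (x ^ p) ⟩
      x ^ p                                   ∎
    shuffle : ∀ a b c → a + (b + c) ≡ c + a + b
    shuffle = solve-∀

  x^p≡x+k*p : ∀ {n} → Prime (suc n) → ∀ x → ∃[ k ] x ^ suc n ≡ x + k * suc n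
  x^p≡x+k*p p-prime zero    = 0 , refl
  x^p≡x+k*p {n} p-prime (suc x) with [x+1]^p≡x^p+1+m*p p-prime x | x^p≡x+k*p p-prime x
  ... | m , [x+1]^p≡ | k , x^p≡ = m + k , (begin
    suc x ^ p             ≡⟨ cong (_^ p) (ℕP.+-comm 1 x) ⟩
    (x + 1) ^ p           ≡⟨ [x+1]^p≡ ⟩
    x ^ p + 1 + m * p     ≡⟨ cong (λ y → y + 1 + m * p) x^p≡ ⟩
    x + k * p + 1 + m * p ≡⟨ regroup x k m p ⟩
    suc x + (m + k) * p   ∎)
    where
    p = suc n
    regroup : ∀ x k m p → x + k * p + 1 + m * p ≡ suc x + (m + k) * p
    regroup = solve-∀

  fermat-little : ∀ {n a} → Prime (suc n) → ¬ suc n ND.∣ a → suc n ND.∣ a ^ n ∸ 1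
  fermat-little {n} {a} p-prime p∤a with x^p≡x+k*p p-prime a
  ... | k , a^p≡ with euclidsLemma a (a ^ n ∸ 1) p-prime (divides k a[a^n-1]≡kp)
    where
    a[a^n-1]≡kp : a * (a ^ n ∸ 1) ≡ k * suc n
    a[a^n-1]≡kp = begin
      a * (a ^ n ∸ 1)      ≡⟨ ℕP.*-distribˡ-∸ a (a ^ n) 1 ⟩
      a ^ suc n ∸ a * 1    ≡⟨ cong₂ _∸_ a^p≡ (ℕP.*-identityʳ a) ⟩
      a + k * suc n ∸ a    ≡⟨ ℕP.m+n∸m≡n a (k * suc n) ⟩
      k * suc n            ∎
  ... | inj₁ p∣a     = contradiction p∣a p∤a
  ... | inj₂ p∣a^n-1 = p∣a^n-1

open Fermat using (fermat-little)

open import Data.Integer.Base using (ℤ; +_; 0ℤ; 1ℤ; _+_; _-_; _*_; _^_; -_; _⊖_; NonZero)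
import Data.Integer.Properties as ℤP
open import Data.Integer.Divisibility using (_∣_)
import Data.Integer.Divisibility.Signed as Signed
open import Data.Integer.Tactic.RingSolver using (solve; solve-∀)
open import Data.List.Base using (_∷_; [])
open import Algebra.Properties.CommutativeSemigroup ℤP.+-commutativeSemigroup using (interchange)

-- Unlike M ∣ x - y in _≡_[mod_], a record type lets Agda infer x and y from a
-- proof, and the explicit quotient makes the ring solver applicable.
infix 4 _≈_⟨mod_⟩
infix 1 _by_
record _≈_⟨mod_⟩ (x y M : ℤ) : Set where
  constructor _by_
  field
    quotient : ℤ
    equation : x ≡ y + quotient * M

module _ {M : ℤ} where

  ≈-reflexive : ∀ {x y} → x ≡ y → x ≈ y ⟨mod M ⟩
  ≈-reflexive {x} refl = 0ℤ by solve (x ∷ M ∷ [])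

  ≈-refl : ∀ {x} → x ≈ x ⟨mod M ⟩
  ≈-refl = ≈-reflexive refl

  ≈-sym : ∀ {x y} → x ≈ y ⟨mod M ⟩ → y ≈ x ⟨mod M ⟩
  ≈-sym {y = y} (k by refl) = - k by solve (y ∷ k ∷ M ∷ [])

  ≈-trans : ∀ {x y z} → x ≈ y ⟨mod M ⟩ → y ≈ z ⟨mod M ⟩ → x ≈ z ⟨mod M ⟩
  ≈-trans {z = z} (k by refl) (l by refl) = l + k by solve (z ∷ k ∷ l ∷ M ∷ [])

  +-cong : ∀ {x x′ y y′} → x ≈ x′ ⟨mod M ⟩ → y ≈ y′ ⟨mod M ⟩ → x + y ≈ x′ + y′ ⟨mod M ⟩
  +-cong {x′ = x} {y′ = y} (k by refl) (l by refl) = k + l by solve (x ∷ y ∷ k ∷ l ∷ M ∷ [])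

  *-cong : ∀ {x x′ y y′} → x ≈ x′ ⟨mod M ⟩ → y ≈ y′ ⟨mod M ⟩ → x * y ≈ x′ * y′ ⟨mod M ⟩
  *-cong {x′ = x} {y′ = y} (k by refl) (l by refl) =
    k * y + x * l + k * l * M by solve (x ∷ y ∷ k ∷ l ∷ M ∷ [])

  +-congˡ : ∀ x {y y′} → y ≈ y′ ⟨mod M ⟩ → x + y ≈ x + y′ ⟨mod M ⟩
  +-congˡ x = +-cong (≈-refl {x})

  +-congʳ : ∀ y {x x′} → x ≈ x′ ⟨mod M ⟩ → x + y ≈ x′ + y ⟨mod M ⟩
  +-congʳ y x≈x′ = +-cong x≈x′ (≈-refl {y})

  *-congˡ : ∀ x {y y′} → y ≈ y′ ⟨mod M ⟩ → x * y ≈ x * y′ ⟨mod M ⟩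
  *-congˡ x = *-cong (≈-refl {x})

  *-congʳ : ∀ y {x x′} → x ≈ x′ ⟨mod M ⟩ → x * y ≈ x′ * y ⟨mod M ⟩
  *-congʳ y x≈x′ = *-cong x≈x′ (≈-refl {y})

  -‿cong : ∀ {x x′} → x ≈ x′ ⟨mod M ⟩ → - x ≈ - x′ ⟨mod M ⟩
  -‿cong {x′ = x} (k by refl) = - k by solve (x ∷ k ∷ M ∷ [])

  ^-cong : ∀ {x x′} n → x ≈ x′ ⟨mod M ⟩ → x ^ n ≈ x′ ^ n ⟨mod M ⟩
  ^-cong zero    x≈x′ = ≈-refl
  ^-cong (suc n) x≈x′ = *-cong x≈x′ (^-cong n x≈x′)

  +-multiple : ∀ x k → x + k * M ≈ x ⟨mod M ⟩
  +-multiple x k = k by refl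

  sum1to-cong : ∀ n {f g} → (∀ a → 1 ≤ a → a ≤ n → f a ≈ g a ⟨mod M ⟩) →
                sum1to n f ≈ sum1to n g ⟨mod M ⟩
  sum1to-cong zero    f≈g = ≈-refl
  sum1to-cong (suc n) f≈g =
    +-cong (sum1to-cong n (λ a 1≤a a≤n → f≈g a 1≤a (ℕP.m≤n⇒m≤1+n a≤n)))
           (f≈g (suc n) (s≤s z≤n) ℕP.≤-refl)

  ≈⇒∣ : ∀ {x y} → x ≈ y ⟨mod M ⟩ → M ∣ x - y
  ≈⇒∣ {x} {y} (k by refl) = Signed.∣⇒∣ᵤ {M} {x - y} (Signed.divides k (solve (y ∷ k ∷ M ∷ [])))

  ∣⇒≈ : ∀ {x y} → M ∣ x - y → x ≈ y ⟨mod M ⟩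
  ∣⇒≈ {x} {y} M∣x-y with Signed.∣ᵤ⇒∣ M∣x-y
  ... | Signed.divides k x-y≡kM = k by (begin
    x           ≡⟨ solve (x ∷ y ∷ []) ⟩
    y + (x - y) ≡⟨ cong (_+_ y) x-y≡kM ⟩
    y + k * M   ∎)
    where open ≡-Reasoning

setoid : ℤ → Setoid _ _
setoid M = record
  { Carrier       = ℤ
  ; _≈_           = _≈_⟨mod M ⟩
  ; isEquivalence = record { refl = ≈-refl ; sym = ≈-sym ; trans = ≈-trans }
  }

module ≈-Reasoning (M : ℤ) = Relation.Binary.Reasoning.Setoid (setoid M)

*-cancelˡ-≈ : ∀ {M x y} .{{_ : NonZero M}} → M * x ≈ M * y ⟨mod M * M ⟩ → x ≈ y ⟨mod M ⟩
*-cancelˡ-≈ {M} {x} {y} (k by eq) =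
  k by ℤP.*-cancelˡ-≡ M x (y + k * M) (trans eq (solve (M ∷ y ∷ k ∷ [])))

x+x≈0⇒x≈0 : ∀ {M x} u → u * + 2 ≈ 1ℤ ⟨mod M ⟩ → x + x ≈ 0ℤ ⟨mod M ⟩ → x ≈ 0ℤ ⟨mod M ⟩
x+x≈0⇒x≈0 {M} {x} u 2u≈1 x+x≈0 = begin
  x            ≡⟨ solve (x ∷ []) ⟩
  1ℤ * x       ≈⟨ *-congʳ x (≈-sym 2u≈1) ⟩
  u * + 2 * x  ≡⟨ solve (u ∷ x ∷ []) ⟩
  u * (x + x)  ≈⟨ *-congˡ u x+x≈0 ⟩
  u * 0ℤ       ≡⟨ ℤP.*-zeroʳ u ⟩
  0ℤ           ∎
  where open ≈-Reasoning M

sum1to-+ : ∀ n f g → sum1to n (λ a → f a + g a) ≡ sum1to n f + sum1to n g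
sum1to-+ zero    f g = refl
sum1to-+ (suc n) f g = begin
  sum1to n (λ a → f a + g a) + (f (suc n) + g (suc n))
    ≡⟨ cong (_+ (f (suc n) + g (suc n))) (sum1to-+ n f g) ⟩
  sum1to n f + sum1to n g + (f (suc n) + g (suc n))
    ≡⟨ interchange (sum1to n f) (sum1to n g) (f (suc n)) (g (suc n)) ⟩
  sum1to n f + f (suc n) + (sum1to n g + g (suc n))
    ∎
  where open ≡-Reasoning

sum1to-zero : ∀ n → sum1to n (λ _ → 0ℤ) ≡ 0ℤ
sum1to-zero zero    = refl
sum1to-zero (suc n) = cong (_+ 0ℤ) (sum1to-zero n)

sum1to-suc : ∀ n f → sum1to (suc n) f ≡ f 1 + sum1to n (λ a → f (suc a))
sum1to-suc zero    f = ℤP.+-comm 0ℤ (f 1)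
sum1to-suc (suc n) f =
  trans (cong (_+ f (suc (suc n))) (sum1to-suc n f)) (ℤP.+-assoc (f 1) _ _)

sum1to-reverse : ∀ n f → sum1to n f ≡ sum1to n (λ a → f (suc n ∸ a))
sum1to-reverse zero    f = refl
sum1to-reverse (suc n) f = begin
  sum1to n f + f (suc n)                      ≡⟨ cong (_+ f (suc n)) (sum1to-reverse n f) ⟩
  sum1to n (λ a → f (suc n ∸ a)) + f (suc n)  ≡⟨ ℤP.+-comm _ (f (suc n)) ⟩
  f (suc n) + sum1to n (λ a → f (suc n ∸ a))  ≡⟨ sum1to-suc n (λ a → f (suc (suc n) ∸ a)) ⟨
  sum1to (suc n) (λ a → f (suc (suc n) ∸ a))  ∎
  where open ≡-Reasoning

sum1to-antisymmetric : ∀ {M} u n {f} → u * + 2 ≈ 1ℤ ⟨mod M ⟩ →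
                       (∀ a → 1 ≤ a → a ≤ n → f (suc n ∸ a) ≈ - f a ⟨mod M ⟩) →
                       sum1to n f ≈ 0ℤ ⟨mod M ⟩
sum1to-antisymmetric {M} u n {f} 2u≈1 f-antisymmetric = x+x≈0⇒x≈0 u 2u≈1 (begin
  sum1to n f + sum1to n f                      ≡⟨ cong (_+_ (sum1to n f)) (sum1to-reverse n f) ⟩
  sum1to n f + sum1to n (λ a → f (suc n ∸ a))  ≡⟨ sum1to-+ n f _ ⟨
  sum1to n (λ a → f a + f (suc n ∸ a))         ≈⟨ sum1to-cong n f[a]+f[n+1-a]≈0 ⟩
  sum1to n (λ _ → 0ℤ)                          ≡⟨ sum1to-zero n ⟩
  0ℤ                                           ∎)
  where
  open ≈-Reasoning M
  f[a]+f[n+1-a]≈0 : ∀ a → 1 ≤ a → a ≤ n → f a + f (suc n ∸ a) ≈ 0ℤ ⟨mod M ⟩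
  f[a]+f[n+1-a]≈0 a 1≤a a≤n =
    ≈-trans (+-congˡ (f a) (f-antisymmetric a 1≤a a≤n)) (≈-reflexive (ℤP.+-inverseʳ (f a)))

-‿^-even : ∀ x k → (- x) ^ (k ℕ.* 2) ≡ x ^ (k ℕ.* 2)
-‿^-even x zero    = refl
-‿^-even x (suc k) = begin
  - x * (- x * (- x) ^ (k ℕ.* 2)) ≡⟨ cong (λ y → - x * (- x * y)) (-‿^-even x k) ⟩
  - x * (- x * x ^ (k ℕ.* 2))     ≡⟨ square-neg x (x ^ (k ℕ.* 2)) ⟩
  x * (x * x ^ (k ℕ.* 2))         ∎
  where
  open ≡-Reasoning
  square-neg : ∀ x y → - x * (- x * y) ≡ x * (x * y)
  square-neg = solve-∀

-‿^-odd : ∀ x k → (- x) ^ suc (k ℕ.* 2) ≡ - x ^ suc (k ℕ.* 2)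
-‿^-odd x k = begin
  - x * (- x) ^ (k ℕ.* 2) ≡⟨ cong (- x *_) (-‿^-even x k) ⟩
  - x * x ^ (k ℕ.* 2)     ≡⟨ ℤP.neg-distribˡ-* x _ ⟨
  - (x * x ^ (k ℕ.* 2))   ∎
  where open ≡-Reasoning

-- Multiplying by x keeps x ^ (n - 1) out of the expansion, so n = 0 needs no care.
[x+Mz]^n*x≈x^n*[x+nMz] : ∀ M x z n →
                         (x + M * z) ^ n * x ≈ x ^ n * (x + + n * (M * z)) ⟨mod M * M ⟩
[x+Mz]^n*x≈x^n*[x+nMz] M x z zero    = ≈-reflexive (solve (M ∷ x ∷ z ∷ []))
[x+Mz]^n*x≈x^n*[x+nMz] M x z (suc n) = begin
  (x + y) * (x + y) ^ n * x
    ≡⟨ ℤP.*-assoc (x + y) _ x ⟩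
  (x + y) * ((x + y) ^ n * x)
    ≈⟨ *-congˡ (x + y) ([x+Mz]^n*x≈x^n*[x+nMz] M x z n) ⟩
  (x + y) * (x ^ n * (x + + n * y))
    ≡⟨ expand M x z (x ^ n) (+ n) ⟩
  x * x ^ n * (x + (1ℤ + + n) * y) + + n * x ^ n * z * z * (M * M)
    ≈⟨ +-multiple _ (+ n * x ^ n * z * z) ⟩
  x * x ^ n * (x + (1ℤ + + n) * y)
    ∎
  where
  open ≈-Reasoning (M * M)
  y = M * z
  expand : ∀ M x z xⁿ n → let y = M * z in
    (x + y) * (xⁿ * (x + n * y)) ≡ x * xⁿ * (x + (1ℤ + n) * y) + n * xⁿ * z * z * (M * M)
  expand = solve-∀

quotient-shift : ∀ n {x w q Q} → x ^ n ≡ 1ℤ + + suc n * q →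
                 (x + + suc n * w) ^ n ≈ 1ℤ + + suc n * Q ⟨mod + suc n * + suc n ⟩ →
                 x * Q ≈ x * q - w ⟨mod + suc n ⟩
quotient-shift n {x} {w} {q} {Q} xⁿ≡ [x+Mw]ⁿ≈ = *-cancelˡ-≈ (begin
  M * (x * Q)                                    ≡⟨ unfold M x Q ⟩
  (1ℤ + M * Q) * x - x                           ≈⟨ +-congʳ (- x) (*-congʳ x (≈-sym [x+Mw]ⁿ≈)) ⟩
  (x + M * w) ^ n * x - x                        ≈⟨ +-congʳ (- x) ([x+Mz]^n*x≈x^n*[x+nMz] M x w n) ⟩
  x ^ n * (x + + n * (M * w)) - x                ≡⟨ cong (λ y → y * (x + + n * (M * w)) - x) xⁿ≡ ⟩
  (1ℤ + M * q) * (x + + n * (M * w)) - x         ≡⟨ regroup x w q (+ n) ⟩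
  M * (x * q - w) + (w + + n * q * w) * (M * M)  ≈⟨ +-multiple _ (w + + n * q * w) ⟩
  M * (x * q - w)                                ∎)
  where
  M = + suc n
  open ≈-Reasoning (M * M)
  unfold : ∀ M x Q → M * (x * Q) ≡ (1ℤ + M * Q) * x - x
  unfold = solve-∀
  regroup : ∀ x w q n → let M = 1ℤ + n in
    (1ℤ + M * q) * (x + n * (M * w)) - x ≡ M * (x * q - w) + (w + n * q * w) * (M * M)
  regroup = solve-∀

pos-^ : ∀ m n → (+ m) ^ n ≡ + (m ℕ.^ n)
pos-^ m zero    = refl
pos-^ m (suc n) = trans (cong (+ m *_) (pos-^ m n)) (sym (ℤP.pos-* m (m ℕ.^ n)))

fermatQuotient-spec : ∀ {n a} → Prime (suc n) → ¬ suc n ND.∣ a →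
                      (+ a) ^ n ≡ 1ℤ + + suc n * fermatQuotient (suc n) a
fermatQuotient-spec {n} {zero}  p-prime p∤a = contradiction (ND._∣0 (suc n)) p∤a
fermatQuotient-spec {n} {suc a} p-prime p∤a = begin
  (+ suc a) ^ n                    ≡⟨ pos-^ (suc a) n ⟩
  + (suc a ℕ.^ n)                  ≡⟨ cong +_ (ℕP.m+[n∸m]≡n (ℕP.m^n>0 (suc a) n)) ⟨
  + (1 ℕ.+ (suc a ℕ.^ n ∸ 1))      ≡⟨ cong (λ m → + (1 ℕ.+ m)) p*qₐ≡aⁿ-1 ⟨
  + (1 ℕ.+ suc n ℕ.* qₐ)           ≡⟨ cong (_+_ 1ℤ) (ℤP.pos-* (suc n) qₐ) ⟩
  1ℤ + + suc n * + qₐ              ∎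
  where
  open ≡-Reasoning
  qₐ = (suc a ℕ.^ n ∸ 1) ℕ./ suc n
  p*qₐ≡aⁿ-1 : suc n ℕ.* qₐ ≡ suc a ℕ.^ n ∸ 1
  p*qₐ≡aⁿ-1 = m*[n/m]≡n (fermat-little p-prime p∤a)

¬2∣n⇒n≡1+k*2 : ∀ n → ¬ 2 ND.∣ n → ∃[ k ] n ≡ suc (k ℕ.* 2)
¬2∣n⇒n≡1+k*2 zero          2∤n = contradiction (ND._∣0 2) 2∤n
¬2∣n⇒n≡1+k*2 (suc zero)    _   = 0 , refl
¬2∣n⇒n≡1+k*2 (suc (suc n)) 2∤n
  with ¬2∣n⇒n≡1+k*2 n (2∤n ∘ ND.∣m∣n⇒∣m+n (ND.∣-refl {2}))
... | k , refl = suc k , refl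

prime⇒¬2∣ : ∀ {p} → Prime p → p ≢ 2 → ¬ 2 ND.∣ p
prime⇒¬2∣ p-prime p≢2 2∣p with prime⇒irreducible p-prime 2∣p
... | inj₁ ()
... | inj₂ 2≡p = p≢2 (sym 2≡p)

pronic : ℤ → ℤ
pronic u = u * (u + 1ℤ)

pronic-cong : ∀ {M x y} → x ≈ y ⟨mod M ⟩ → pronic x ≈ pronic y ⟨mod M ⟩
pronic-cong x≈y = *-cong x≈y (+-congʳ 1ℤ x≈y)

pronic-reflect : ∀ u → pronic (- (u + 1ℤ)) ≡ pronic u
pronic-reflect u = expanded u
  where
  expanded : ∀ u → - (u + 1ℤ) * (- (u + 1ℤ) + 1ℤ) ≡ u * (u + 1ℤ)
  expanded = solve-∀

module OddPrime (k : ℕ) (p-prime : Prime (suc (k ℕ.* 2))) where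

  n p : ℕ
  n = k ℕ.* 2
  p = suc n

  P : ℤ
  P = + p

  q : ℕ → ℤ
  q = fermatQuotient p

  aⁿ≡1+P*qₐ : ∀ {a} → 1 ≤ a → a ≤ n → (+ a) ^ n ≡ 1ℤ + P * q a
  aⁿ≡1+P*qₐ {suc a} _ a≤n = fermatQuotient-spec p-prime p∤1+a
    where
    p∤1+a : ¬ p ND.∣ suc a
    p∤1+a p∣1+a = ℕP.<⇒≱ (s≤s a≤n) (ND.∣⇒≤ p∣1+a)

  +[p∸a]≡-a+P : ∀ {a} → a ≤ n → + (p ∸ a) ≡ - (+ a) + P * 1ℤ
  +[p∸a]≡-a+P {a} a≤n = begin
    + (p ∸ a)         ≡⟨ ℤP.⊖-≥ (ℕP.m≤n⇒m≤1+n a≤n) ⟨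
    p ⊖ a             ≡⟨ ℤP.m-n≡m⊖n p a ⟨
    P - + a           ≡⟨ ℤP.+-comm P (- (+ a)) ⟩
    - (+ a) + P       ≡⟨ cong (_+_ (- (+ a))) (ℤP.*-identityʳ P) ⟨
    - (+ a) + P * 1ℤ  ∎
    where open ≡-Reasoning

  p∸a≈-a : ∀ {a} → a ≤ n → + (p ∸ a) ≈ - (+ a) ⟨mod P ⟩
  p∸a≈-a {a} a≤n = 1ℤ by trans (+[p∸a]≡-a+P a≤n) (cong (_+_ (- (+ a))) (ℤP.*-comm P 1ℤ))

  a*q[p∸a]≈a*qₐ+1 : ∀ {a} → 1 ≤ a → a ≤ n → (+ a) * q (p ∸ a) ≈ (+ a) * q a + 1ℤ ⟨mod P ⟩
  a*q[p∸a]≈a*qₐ+1 {a} 1≤a a≤n = begin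
    (+ a) * q (p ∸ a)        ≡⟨ negate-twice (+ a) (q (p ∸ a)) ⟩
    - (- (+ a) * q (p ∸ a))  ≈⟨ -‿cong (quotient-shift n -aⁿ≡ (≈-reflexive [-a+P]ⁿ≡)) ⟩
    - (- (+ a) * q a - 1ℤ)   ≡⟨ negate-twice-pred (+ a) (q a) ⟩
    (+ a) * q a + 1ℤ         ∎
    where
    open ≈-Reasoning P
    -aⁿ≡ : (- (+ a)) ^ n ≡ 1ℤ + P * q a
    -aⁿ≡ = trans (-‿^-even (+ a) k) (aⁿ≡1+P*qₐ 1≤a a≤n)
    [-a+P]ⁿ≡ : (- (+ a) + P * 1ℤ) ^ n ≡ 1ℤ + P * q (p ∸ a)
    [-a+P]ⁿ≡ = trans (cong (_^ n) (sym (+[p∸a]≡-a+P a≤n)))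
                     (aⁿ≡1+P*qₐ (ℕP.m<n⇒0<n∸m (s≤s a≤n)) (ℕP.∸-monoʳ-≤ p 1≤a))
    negate-twice : ∀ x y → x * y ≡ - (- x * y)
    negate-twice = solve-∀
    negate-twice-pred : ∀ x y → - (- x * y - 1ℤ) ≡ x * y + 1ℤ
    negate-twice-pred = solve-∀

  v≈a*qₐ : ∀ {a} v → 1 ≤ a → a ≤ n → ((+ a) + P * v) ^ n ≈ 1ℤ ⟨mod P * P ⟩ →
           v ≈ (+ a) * q a ⟨mod P ⟩
  v≈a*qₐ {a} v 1≤a a≤n [a+Pv]ⁿ≈1 = begin
    v                                ≡⟨ sub-sub (+ a * q a) v ⟩
    (+ a) * q a - ((+ a) * q a - v)  ≈⟨ +-congˡ (+ a * q a) (-‿cong (≈-sym shifted)) ⟩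
    (+ a) * q a - (+ a) * 0ℤ         ≡⟨ sub-zero (+ a * q a) (+ a) ⟩
    (+ a) * q a                      ∎
    where
    open ≈-Reasoning P
    1≡1+P*0 : 1ℤ ≡ 1ℤ + P * 0ℤ
    1≡1+P*0 = cong (_+_ 1ℤ) (sym (ℤP.*-zeroʳ P))
    shifted : (+ a) * 0ℤ ≈ (+ a) * q a - v ⟨mod P ⟩
    shifted = quotient-shift n (aⁿ≡1+P*qₐ 1≤a a≤n) (≈-trans [a+Pv]ⁿ≈1 (≈-reflexive 1≡1+P*0))
    sub-sub : ∀ x y → y ≡ x - (x - y)
    sub-sub = solve-∀
    sub-zero : ∀ x y → x - y * 0ℤ ≡ x
    sub-zero = solve-∀

  [k+1]*2≈1 : (+ k + 1ℤ) * + 2 ≈ 1ℤ ⟨mod P ⟩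
  [k+1]*2≈1 = 1ℤ by (begin
    (+ k + 1ℤ) * + 2            ≡⟨ double (+ k) ⟩
    1ℤ + 1ℤ * (1ℤ + + k * + 2)  ≡⟨ cong (λ m → 1ℤ + 1ℤ * (1ℤ + m)) (ℤP.pos-* k 2) ⟨
    1ℤ + 1ℤ * P                 ∎)
    where
    open ≡-Reasoning
    double : ∀ k → (k + 1ℤ) * + 2 ≡ 1ℤ + 1ℤ * (1ℤ + k * + 2)
    double = solve-∀

  module OddExponent (j : ℕ) where

    e : ℕ
    e = suc (j ℕ.* 2)

    F : ℕ → ℤ
    F a = (+ a) ^ e * pronic ((+ a) * q a)

    F[p∸a]≈-F[a] : ∀ a → 1 ≤ a → a ≤ n → F (p ∸ a) ≈ - F a ⟨mod P ⟩
    F[p∸a]≈-F[a] a 1≤a a≤n = begin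
      (+ (p ∸ a)) ^ e * pronic (+ (p ∸ a) * q (p ∸ a))
        ≈⟨ *-cong (^-cong e (p∸a≈-a a≤n)) (pronic-cong (*-congʳ (q (p ∸ a)) (p∸a≈-a a≤n))) ⟩
      (- (+ a)) ^ e * pronic (- (+ a) * q (p ∸ a))
        ≡⟨ cong₂ _*_ (-‿^-odd (+ a) j) (cong pronic (sym (ℤP.neg-distribˡ-* (+ a) _))) ⟩
      - (+ a) ^ e * pronic (- ((+ a) * q (p ∸ a)))
        ≈⟨ *-congˡ (- (+ a) ^ e) (pronic-cong (-‿cong (a*q[p∸a]≈a*qₐ+1 1≤a a≤n))) ⟩
      - (+ a) ^ e * pronic (- ((+ a) * q a + 1ℤ))
        ≡⟨ cong (_*_ (- (+ a) ^ e)) (pronic-reflect ((+ a) * q a)) ⟩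
      - (+ a) ^ e * pronic ((+ a) * q a)
        ≡⟨ ℤP.neg-distribˡ-* ((+ a) ^ e) _ ⟨
      - F a
        ∎
      where open ≈-Reasoning P

    ΣF≈0 : sum1to n F ≈ 0ℤ ⟨mod P ⟩
    ΣF≈0 = sum1to-antisymmetric (+ k + 1ℤ) n {F} [k+1]*2≈1 F[p∸a]≈-F[a]

    version1 : sum1to n (λ a → q a ^ 2 * (+ a) ^ suc (suc e))
                 ≈ - sum1to n (λ a → q a * (+ a) ^ suc e) ⟨mod P ⟩
    version1 = begin
      S₁                                 ≡⟨ add-sub S₁ S₂ ⟩
      S₁ + S₂ - S₂                       ≡⟨ cong (_- S₂) (sum1to-+ n f₁ f₂) ⟨
      sum1to n (λ a → f₁ a + f₂ a) - S₂  ≈⟨ +-congʳ (- S₂) (sum1to-cong n f₁+f₂≈F) ⟩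
      sum1to n F - S₂                    ≈⟨ +-congʳ (- S₂) ΣF≈0 ⟩
      0ℤ - S₂                            ≡⟨ ℤP.+-identityˡ (- S₂) ⟩
      - S₂                               ∎
      where
      open ≈-Reasoning P
      f₁ f₂ : ℕ → ℤ
      f₁ a = q a ^ 2 * (+ a) ^ suc (suc e)
      f₂ a = q a * (+ a) ^ suc e
      S₁ = sum1to n f₁
      S₂ = sum1to n f₂
      expand : ∀ q a aᵉ →
        q * (q * 1ℤ) * (a * (a * aᵉ)) + q * (a * aᵉ) ≡ aᵉ * ((a * q) * (a * q + 1ℤ))
      expand = solve-∀
      f₁+f₂≈F : ∀ a → 1 ≤ a → a ≤ n → f₁ a + f₂ a ≈ F a ⟨mod P ⟩
      f₁+f₂≈F a _ _ = ≈-reflexive (expand (q a) (+ a) ((+ a) ^ e))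
      add-sub : ∀ x y → x ≡ x + y - y
      add-sub = solve-∀

    version2 : (v : ℕ → ℤ) →
               (∀ a → 1 ≤ a → a ≤ n → ((+ a) + P * v a) ^ n ≈ 1ℤ ⟨mod P * P ⟩) →
               sum1to n (λ a → q a * (+ a) ^ suc e * (1ℤ + v a)) ≈ 0ℤ ⟨mod P ⟩
    version2 v ω = ≈-trans (sum1to-cong n term≈F) ΣF≈0
      where
      term≈F : ∀ a → 1 ≤ a → a ≤ n → q a * (+ a) ^ suc e * (1ℤ + v a) ≈ F a ⟨mod P ⟩
      term≈F a 1≤a a≤n = begin
        q a * (+ a) ^ suc e * (1ℤ + v a)
          ≈⟨ *-congˡ (q a * (+ a) ^ suc e) (+-congˡ 1ℤ (v≈a*qₐ (v a) 1≤a a≤n (ω a 1≤a a≤n))) ⟩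
        q a * (+ a) ^ suc e * (1ℤ + (+ a) * q a)
          ≡⟨ expand (q a) (+ a) ((+ a) ^ e) ⟩
        F a
          ∎
        where
        open ≈-Reasoning P
        expand : ∀ q a aᵉ → q * (a * aᵉ) * (1ℤ + a * q) ≡ aᵉ * ((a * q) * (a * q + 1ℤ))
        expand = solve-∀

corollary1 : (p t : ℕ) → Prime p → 11 ≤ p → ¬ (2 ND.∣ t) → 5 ≤ t → t ≤ p ∸ 2 →
    (sum1to (p ∸ 1) (λ a → (fermatQuotient p a ^ 2) * ((+ a) ^ t))
       ≡ - sum1to (p ∸ 1) (λ a → fermatQuotient p a * ((+ a) ^ (t ∸ 1))) [mod p ])
    × ((v : ℕ → ℤ) →
       ((a : ℕ) → 1 ≤ a → a ≤ p ∸ 1 →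
          ((+ p) * (+ p)) ∣ (((+ a) + (+ p) * v a) ^ (p ∸ 1) - + 1)) →
       sum1to (p ∸ 1) (λ a → fermatQuotient p a * ((+ a) ^ (t ∸ 1)) * (+ 1 + v a))
         ≡ + 0 [mod p ])
corollary1 p t p-prime 11≤p 2∤t 5≤t _
  with ¬2∣n⇒n≡1+k*2 p (prime⇒¬2∣ p-prime p≢2) | ¬2∣n⇒n≡1+k*2 t 2∤t
  where
  p≢2 : p ≢ 2
  p≢2 refl = contradiction 11≤p λ { (s≤s (s≤s ())) }
... | k , refl | zero  , refl = contradiction 5≤t λ { (s≤s ()) }
... | k , refl | suc j , refl =
  ≈⇒∣ version1 , λ v ω → ≈⇒∣ (version2 v (λ a 1≤a a≤n → ∣⇒≈ (ω a 1≤a a≤n)))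
  where
  open OddPrime k p-prime
  open OddExponent j
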